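{- For $k\ge1$ and $n\ge0$, the prefix of $x_k$ of length $n$ satisfies $x_k[0{:}n)=W_k(D_k(n))$. Moreover, for all $q\ge0$, $\tau_k^q(x_k[0{:}n))=W_k(D_k(n)+q)$, where $D_k(n)+q=\{p+q:p\in D_k(n)\}$.
   Context: For $k\ge1$, $\tau_k$ is the substitution on the alphabet $\{1,\ldots,k\}$ given by $\tau_k(k)=k1$ and $\tau_k(i)=i+1$ for $1\le i<k$, extended to words morphically, and $x_k=x_k[0]x_k[1]\cdots$ is the infinite fixed point of $\tau_k$; $x_k[0{:}n)=x_k[0]\cdots x_k[n-1]$. The sequence $(A_{k,p})_{p\ge0}$ is defined by $A_{k,p}=p+1$ for $0\le p<k$ and $A_{k,p}=A_{k,p-1}+A_{k,p-k}$ for $p\ge k$. For $n\ge0$, $D_k(n)$ denotes the unique finite set $D\subset\mathbb{N}$ whose elements are pairwise at distance at least $k$ and such that $\sum_{p\in D}A_{k,p}=n$. For a finite set $D=\{p_0<p_1<\cdots<p_m\}\subset\mathbb{N}$, $W_k(D)$ is the word $\tau_k^{p_m}(k)\,\tau_k^{p_{m-1}}(k)\cdots\tau_k^{p_0}(k)$ (the empty word if $D=\varnothing$). -}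

module Defs where

open import Data.Nat using (ℕ; zero; suc; _+_; _∸_; _<_; _≤_; _<ᵇ_)
open import Data.Bool using (if_then_else_)
open import Data.List using (List; []; _∷_; _++_; concatMap; take; map; reverse; concat)
open import Data.Nat.ListAction using (sum)
open import Function using (_∘_)

Word : Set
Word = List ℕ

-- τ_k on letters: τ_k(i) = i+1 for i < k, τ_k(k) = k 1.
-- (Letters ≥ k are all sent to k 1; only letters in {1,…,k} ever occur.)
τ-letter : ℕ → ℕ → Word
τ-letter k i = if i <ᵇ k then suc i ∷ [] else k ∷ 1 ∷ []

τ : ℕ → Word → Word
τ k = concatMap (τ-letter k)

τ^ : ℕ → ℕ → Word → Word
τ^ k zero w = w
τ^ k (suc q) w = τ k (τ^ k q w)

-- Prefix x_k[0:n) of the fixed point x_k = lim_p τ_k^p(k).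
-- Since |τ_k^p(k)| ≥ p+1 and τ_k^p(k) is a prefix of τ_k^(p+1)(k),
-- the first n letters of x_k are those of τ_k^n(k).
prefix : ℕ → ℕ → Word
prefix k n = take n (τ^ k n (k ∷ []))

-- A_{k,p}: p+1 for p < k, A_{k,p-1} + A_{k,p-k} for p ≥ k (k ≥ 1).
-- Computed with fuel; fuel p+1 always suffices when k ≥ 1.
A-fuel : ℕ → ℕ → ℕ → ℕ
A-fuel zero k p = 0
A-fuel (suc f) k p =
  if p <ᵇ k then suc p else A-fuel f k (p ∸ 1) + A-fuel f k (p ∸ k)

A : ℕ → ℕ → ℕ
A k p = A-fuel (suc p) k p

-- W_k(D) for D = {p_0 < … < p_m} given as the increasing list p_0 ∷ … ∷ p_m:
-- W_k(D) = τ^{p_m}(k) τ^{p_{m-1}}(k) ⋯ τ^{p_0}(k).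
W : ℕ → List ℕ → Word
W k D = concat (map (λ p → τ^ k p (k ∷ [])) (reverse D))

ΣA : ℕ → List ℕ → ℕ
ΣA k D = sum (map (A k) D)

shift : ℕ → List ℕ → List ℕ
shift q D = map (_+ q) D

-- Let B p = τ_k^p(k). From τ_k(k) = k1 we get B (p+1) = B p · τ_k^p(1), so the B p form a
-- chain of prefixes of x_k with |B p| > p; and since τ_k^(k-1)(1) = k = B 0, also
-- B (p+1) = B p · B (p+1-k) for p ≥ k-1, whence |B p| = A_{k,p}. Going up through
-- D = {p_0 < ⋯ < p_m}, this identity shows inductively that B p_i ⋯ B p_0 is a prefix of
-- B (p_i + 1), because B p_(i-1) ⋯ B p_0 is a prefix of B (p_(i-1) + 1), which is a prefix
-- of B (p_i + 1 - k). Hence W_k(D) is a prefix of B n, of length Σ A_{k,p} = n. The second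
-- claim holds because τ_k^q is a morphism sending B p to B (p+q).
module Submission where

open import Defs
open import Data.Nat using (ℕ; zero; suc; _+_; _∸_; _≤_; _<_; _<ᵇ_; _≤′_; ≤′-refl; ≤′-step; z≤n; s≤s; s<s)
open import Data.Nat.Properties
open import Data.Nat.ListAction using (sum)
open import Data.Bool using (true; false)
open import Data.List using (List; []; _∷_; _++_; take; map; reverse; concat; length)
open import Data.List.Properties using (++-monoid; concatMap-++; ++-assoc; ++-identityʳ; length-++; map-++; concat-++; unfold-reverse)
open import Data.List.Relation.Unary.All using (All; []; _∷_)
import Data.List.Relation.Unary.All as All
open import Data.List.Relation.Unary.All.Properties using (map⁻)
open import Data.List.Relation.Unary.AllPairs using (AllPairs; []; _∷_)
open import Data.Product using (_×_; _,_)
open import Function using (_∘_)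
open import Relation.Nullary using (contradiction)
open import Relation.Nullary.Reflects using (ofʸ; ofⁿ)
open import Relation.Binary.PropositionalEquality
open import Algebra.Properties.Monoid.Divisibility (++-monoid ℕ)
  using (_∣ˡ_; _,_; ε∣ˡ_; ∣ˡ-refl; ∣ˡ-trans; ∣ˡ-respʳ-≈; ∣ˡ-respˡ-≈; x∣ˡy⇒zx∣ˡzy; xy≈z⇒x∣ˡz)

private variable
  k j p q x y : ℕ
  u v w : Word

take-length-∣ˡ : u ∣ˡ v → take (length u) v ≡ u
take-length-∣ˡ {[]} _ = refl
take-length-∣ˡ {a ∷ u} (w , refl) = cong (a ∷_) (take-length-∣ˡ (w , refl))

All-≤-sum : ∀ ns → All (_≤ sum ns) ns
All-≤-sum [] = []
All-≤-sum (n ∷ ns) =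
  m≤m+n n (sum ns) ∷ All.map (λ m≤ → ≤-trans m≤ (m≤n+m (sum ns) n)) (All-≤-sum ns)

τ-letter-< : x < k → τ-letter k x ≡ suc x ∷ []
τ-letter-< {x} {k} x<k with x <ᵇ k | <⇒<ᵇ x<k
... | true  | _  = refl
... | false | ()

τ-letter-self : ∀ k → τ-letter k k ≡ k ∷ 1 ∷ []
τ-letter-self k with k <ᵇ k | <ᵇ⇒< k k
... | false | _   = refl
... | true  | k<k = contradiction (k<k _) (n≮n k)

τ-++ : ∀ u v → τ k (u ++ v) ≡ τ k u ++ τ k v
τ-++ {k} = concatMap-++ (τ-letter k)

τ^-++ : ∀ q u v → τ^ k q (u ++ v) ≡ τ^ k q u ++ τ^ k q v
τ^-++ zero    u v = refl
τ^-++ {k} (suc q) u v = trans (cong (τ k) (τ^-++ q u v)) (τ-++ (τ^ k q u) (τ^ k q v))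

τ^-[] : ∀ q → τ^ k q [] ≡ []
τ^-[] zero    = refl
τ^-[] (suc q) = cong (τ _) (τ^-[] q)

τ^-τ^ : ∀ q → τ^ k q (τ^ k p w) ≡ τ^ k (p + q) w
τ^-τ^ {k} {p} {w} zero    = cong (λ n → τ^ k n w) (sym (+-identityʳ p))
τ^-τ^ {k} {p} {w} (suc q) =
  trans (cong (τ k) (τ^-τ^ {k} {p} {w} q)) (cong (λ n → τ^ k n w) (sym (+-suc p q)))

τ^-1 : p < k → τ^ k p (1 ∷ []) ≡ suc p ∷ []
τ^-1 {zero}  _   = refl
τ^-1 {suc p} p<k = trans (cong (τ _) (τ^-1 (<-trans (n<1+n p) p<k)))
                         (cong (_++ []) (τ-letter-< p<k))

τ-letter-nonempty : ∀ k x → 1 ≤ length (τ-letter k x)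
τ-letter-nonempty k x with x <ᵇ k
... | true  = s≤s z≤n
... | false = s≤s z≤n

length-τ-≥ : ∀ u → length u ≤ length (τ k u)
length-τ-≥ []          = z≤n
length-τ-≥ {k} (x ∷ u) = begin
  1 + length u                             ≤⟨ +-mono-≤ (τ-letter-nonempty k x) (length-τ-≥ u) ⟩
  length (τ-letter k x) + length (τ k u)   ≡⟨ length-++ (τ-letter k x) ⟨
  length (τ k (x ∷ u))                     ∎
  where open ≤-Reasoning

length-τ^-≥ : ∀ q u → length u ≤ length (τ^ k q u)
length-τ^-≥ zero    u = ≤-refl
length-τ^-≥ {k} (suc q) u = ≤-trans (length-τ^-≥ q u) (length-τ-≥ (τ^ k q u))

block : ℕ → ℕ → Word
block k p = τ^ k p (k ∷ [])

block-suc : ∀ p → block k (suc p) ≡ block k p ++ τ^ k p (1 ∷ [])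
block-suc {k} p = begin
  block k (suc p)                      ≡⟨ τ^-τ^ {p = 1} p ⟨
  τ^ k p (τ k (k ∷ []))                ≡⟨ cong (τ^ k p ∘ (_++ [])) (τ-letter-self k) ⟩
  τ^ k p ((k ∷ []) ++ 1 ∷ [])          ≡⟨ τ^-++ p (k ∷ []) (1 ∷ []) ⟩
  block k p ++ τ^ k p (1 ∷ [])         ∎
  where open ≡-Reasoning

block-∣ˡ-suc : ∀ p → block k p ∣ˡ block k (suc p)
block-∣ˡ-suc p = xy≈z⇒x∣ˡz _ _ (sym (block-suc p))

block-mono : p ≤ q → block k p ∣ˡ block k q
block-mono = go ∘ ≤⇒≤′
  where
  go : p ≤′ q → block k p ∣ˡ block k q
  go ≤′-refl                    = ∣ˡ-refl
  go {q = suc q} (≤′-step p≤′q) = ∣ˡ-trans (go p≤′q) (block-∣ˡ-suc q)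

length-block-> : ∀ p → p < length (block k p)
length-block-> zero    = s≤s z≤n
length-block-> {k} (suc p) = begin-strict
  suc p                                            <⟨ s<s (length-block-> p) ⟩
  suc (length (block k p))                         ≡⟨ +-comm 1 (length (block k p)) ⟩
  length (block k p) + 1                           ≤⟨ +-monoʳ-≤ (length (block k p)) (length-τ^-≥ p (1 ∷ [])) ⟩
  length (block k p) + length (τ^ k p (1 ∷ []))    ≡⟨ length-++ (block k p) ⟨
  length (block k p ++ τ^ k p (1 ∷ []))            ≡⟨ cong length (block-suc p) ⟨
  length (block k (suc p))                         ∎
  where open ≤-Reasoning

length-block-< : p < k → length (block k p) ≡ suc p
length-block-< {zero}      _   = refl
length-block-< {suc p} {k} p<k = begin
  length (block k (suc p))                ≡⟨ cong length (block-suc p) ⟩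
  length (block k p ++ τ^ k p (1 ∷ []))   ≡⟨ cong (length ∘ (block k p ++_)) (τ^-1 (<-trans (n<1+n p) p<k)) ⟩
  length (block k p ++ suc p ∷ [])        ≡⟨ length-++ (block k p) ⟩
  length (block k p) + 1                  ≡⟨ cong (_+ 1) (length-block-< (<-trans (n<1+n p) p<k)) ⟩
  suc p + 1                               ≡⟨ +-comm (suc p) 1 ⟩
  suc (suc p)                             ∎
  where open ≡-Reasoning

block-+ : ∀ p q → τ^ k q (block k p) ≡ block k (p + q)
block-+ {k} p q = τ^-τ^ {k} {p} {k ∷ []} q

block-step : ∀ j r → block (suc j) (suc j + r) ≡ block (suc j) (j + r) ++ block (suc j) r
block-step j r = begin
  B (suc j + r)                      ≡⟨ block-+ (suc j) r ⟨
  τ^′ (B (suc j))                    ≡⟨ cong τ^′ (block-suc j) ⟩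
  τ^′ (B j ++ τ^ (suc j) j (1 ∷ []))  ≡⟨ cong (τ^′ ∘ (B j ++_)) (τ^-1 (n<1+n j)) ⟩
  τ^′ (B j ++ B 0)                   ≡⟨ τ^-++ r (B j) (B 0) ⟩
  τ^′ (B j) ++ τ^′ (B 0)             ≡⟨ cong₂ _++_ (block-+ j r) (block-+ 0 r) ⟩
  B (j + r) ++ B r                   ∎
  where
  open ≡-Reasoning
  B : ℕ → Word
  B = block (suc j)
  τ^′ : Word → Word
  τ^′ = τ^ (suc j) r

block-suc-∸ : j ≤ p → block (suc j) (suc p) ≡ block (suc j) p ++ block (suc j) (p ∸ j)
block-suc-∸ {j} j≤p with r , refl ← m≤n⇒∃[o]m+o≡n j≤p =
  trans (block-step j r) (cong ((block (suc j) (j + r) ++_) ∘ block (suc j)) (sym (m+n∸m≡n j r)))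

A-fuel-length : ∀ f p → p < f → A-fuel f (suc j) p ≡ length (block (suc j) p)
A-fuel-length {j} (suc f) p p<1+f with p <ᵇ suc j | <ᵇ-reflects-< p (suc j)
... | true  | ofʸ p<k = sym (length-block-< p<k)
... | false | ofⁿ p≮k with ≮⇒≥ p≮k
...   | s≤s {n = p′} j≤p′ = begin
  A-fuel f (suc j) p′ + A-fuel f (suc j) (p′ ∸ j)
    ≡⟨ cong₂ _+_ (A-fuel-length f p′ (≤-pred p<1+f))
                 (A-fuel-length f (p′ ∸ j) (≤-<-trans (m∸n≤m p′ j) (≤-pred p<1+f))) ⟩
  length (block (suc j) p′) + length (block (suc j) (p′ ∸ j))
    ≡⟨ length-++ (block (suc j) p′) ⟨
  length (block (suc j) p′ ++ block (suc j) (p′ ∸ j))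
    ≡⟨ cong length (block-suc-∸ j≤p′) ⟨
  length (block (suc j) (suc p′))
    ∎
  where open ≡-Reasoning

length-block : ∀ p → length (block (suc j) p) ≡ A (suc j) p
length-block p = sym (A-fuel-length (suc p) p ≤-refl)

<-A : ∀ p → p < A (suc j) p
<-A {j} p = subst (p <_) (length-block p) (length-block-> p)

Spaced : ℕ → List ℕ → Set
Spaced k = AllPairs (λ p p′ → p + k ≤ p′)

W-∷ : ∀ x xs → W k (x ∷ xs) ≡ W k xs ++ block k x
W-∷ {k} x xs = begin
  concat (map (block k) (reverse (x ∷ xs)))                 ≡⟨ cong (concat ∘ map (block k)) (unfold-reverse x xs) ⟩
  concat (map (block k) (reverse xs ++ x ∷ []))             ≡⟨ cong concat (map-++ (block k) (reverse xs) (x ∷ [])) ⟩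
  concat (map (block k) (reverse xs) ++ block k x ∷ [])     ≡⟨ concat-++ (map (block k) (reverse xs)) (block k x ∷ []) ⟨
  W k xs ++ block k x ++ []                                 ≡⟨ cong (W k xs ++_) (++-identityʳ (block k x)) ⟩
  W k xs ++ block k x                                       ∎
  where open ≡-Reasoning

length-W : ∀ D → length (W (suc j) D) ≡ ΣA (suc j) D
length-W [] = refl
length-W {j} (x ∷ xs) = begin
  length (W (suc j) (x ∷ xs))                        ≡⟨ cong length (W-∷ x xs) ⟩
  length (W (suc j) xs ++ block (suc j) x)           ≡⟨ length-++ (W (suc j) xs) ⟩
  length (W (suc j) xs) + length (block (suc j) x)   ≡⟨ cong₂ _+_ (length-W xs) (length-block x) ⟩
  ΣA (suc j) xs + A (suc j) x                        ≡⟨ +-comm (ΣA (suc j) xs) (A (suc j) x) ⟩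
  ΣA (suc j) (x ∷ xs)                                ∎
  where open ≡-Reasoning

τ^-W : ∀ q D → τ^ k q (W k D) ≡ W k (shift q D)
τ^-W q [] = τ^-[] q
τ^-W {k} q (x ∷ xs) = begin
  τ^ k q (W k (x ∷ xs))                      ≡⟨ cong (τ^ k q) (W-∷ x xs) ⟩
  τ^ k q (W k xs ++ block k x)               ≡⟨ τ^-++ q (W k xs) (block k x) ⟩
  τ^ k q (W k xs) ++ τ^ k q (block k x)      ≡⟨ cong₂ _++_ (τ^-W q xs) (block-+ x q) ⟩
  W k (shift q xs) ++ block k (x + q)        ≡⟨ W-∷ (x + q) (shift q xs) ⟨
  W k (shift q (x ∷ xs))                     ∎
  where open ≡-Reasoning

block-++-∣ˡ-block-suc : x + suc j ≤ y → v ∣ˡ block (suc j) (suc x)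
                      → (block (suc j) y ++ v) ∣ˡ block (suc j) (suc y)
block-++-∣ˡ-block-suc {x} {j} {y} x+k≤y v∣ =
  ∣ˡ-respʳ-≈ (sym (block-suc-∸ j≤y))
    (x∣ˡy⇒zx∣ˡzy (block (suc j) y) (∣ˡ-trans v∣ (block-mono (m+n≤o⇒m≤o∸n (suc x) 1+x+j≤y))))
  where
  1+x+j≤y : suc x + j ≤ y
  1+x+j≤y = subst (_≤ y) (+-suc x j) x+k≤y
  j≤y : j ≤ y
  j≤y = ≤-trans (m≤n+m j (suc x)) 1+x+j≤y

W-++-∣ˡ-block : ∀ {xs P} → Spaced (suc j) (x ∷ xs) → All (_< P) (x ∷ xs)
              → v ∣ˡ block (suc j) (suc x) → (W (suc j) xs ++ v) ∣ˡ block (suc j) P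
W-++-∣ˡ-block {xs = []} _ (x<P ∷ _) v∣ = ∣ˡ-trans v∣ (block-mono x<P)
W-++-∣ˡ-block {j} {v = v} {y ∷ ys} ((x+k≤y ∷ _) ∷ spaced) (_ ∷ <P) v∣ =
  ∣ˡ-respˡ-≈ reassoc (W-++-∣ˡ-block spaced <P (block-++-∣ˡ-block-suc x+k≤y v∣))
  where
  open ≡-Reasoning
  reassoc : W (suc j) ys ++ (block (suc j) y ++ v) ≡ W (suc j) (y ∷ ys) ++ v
  reassoc = begin
    W (suc j) ys ++ (block (suc j) y ++ v)   ≡⟨ ++-assoc (W (suc j) ys) (block (suc j) y) v ⟨
    (W (suc j) ys ++ block (suc j) y) ++ v   ≡⟨ cong (_++ v) (W-∷ y ys) ⟨
    W (suc j) (y ∷ ys) ++ v                  ∎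

W-∣ˡ-block : ∀ {D P} → Spaced (suc j) D → All (_< P) D → W (suc j) D ∣ˡ block (suc j) P
W-∣ˡ-block {D = []}     _      _   = ε∣ˡ _
W-∣ˡ-block {D = x ∷ xs} spaced <P =
  ∣ˡ-respˡ-≈ (sym (W-∷ x xs)) (W-++-∣ˡ-block spaced <P (block-∣ˡ-suc x))

prefix-ΣA : ∀ {D} → Spaced (suc j) D → prefix (suc j) (ΣA (suc j) D) ≡ W (suc j) D
prefix-ΣA {j} {D} spaced = begin
  take n (block (suc j) n)                      ≡⟨ cong (λ m → take m (block (suc j) n)) (length-W D) ⟨
  take (length (W (suc j) D)) (block (suc j) n) ≡⟨ take-length-∣ˡ (W-∣ˡ-block spaced D<n) ⟩
  W (suc j) D                                   ∎
  where
  open ≡-Reasoning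
  n : ℕ
  n = ΣA (suc j) D
  D<n : All (_< n) D
  D<n = All.map (λ {d} Ad≤n → <-≤-trans (<-A d) Ad≤n) (map⁻ (All-≤-sum (map (A (suc j)) D)))

theorem5p5 : (k : ℕ) → 1 ≤ k → (n : ℕ) → (D : List ℕ)
    → AllPairs (λ p p′ → p + k ≤ p′) D
    → ΣA k D ≡ n
    → (prefix k n ≡ W k D)
      × ((q : ℕ) → τ^ k q (prefix k n) ≡ W k (shift q D))
theorem5p5 (suc j) (s≤s z≤n) _ D spaced refl =
  prefix-ΣA spaced , λ q → trans (cong (τ^ (suc j) q) (prefix-ΣA spaced)) (τ^-W q D)
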